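{- Let $S$ be a finite set of positive integers with largest element $k$, and suppose the smallest positive integer not in $S$ is $k-c$ for some integer $c>0$. Let $(a_n)_{n\ge1}$ be the $S$-LID sequence. Let $n\ge k+1$ be an integer. If \[ a_n + a_{n-k} \ >\ \sum_{\substack{i\ge 0\\ i(k-c)<n-1}} a_{n-1-i(k-c)} = a_{n-1}+a_{n-1-(k-c)}+a_{n-1-2(k-c)}+\cdots, \] then $a_{n+1}=a_n+a_{n-k}$.
   Context: For a set $S$ of positive integers, the $S$-legal index difference ($S$-LID) sequence $(a_n)_{n\ge 1}$ is defined recursively: for each positive integer $n$, $a_n$ is the smallest positive integer that cannot be written as $\sum_{\ell\in L} a_\ell$ for some set $L \subseteq \{1,\dots,n-1\}$ such that $|i-j|\notin S$ for all $i,j\in L$ (the empty sum is $0$). -}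

module Defs where

open import Data.Nat using (ℕ; zero; suc; _+_; _*_; _∸_; _≤_; _<_; ∣_-_∣)
open import Data.Nat.Properties using (_<?_)
open import Data.List using (List; map; filter; upTo)
open import Data.Nat.ListAction using (sum)
open import Data.List.Membership.Propositional using (_∈_; _∉_)
open import Data.List.Relation.Unary.Unique.Propositional using (Unique)
open import Data.Product using (Σ; _×_)
open import Relation.Binary.PropositionalEquality using (_≡_)
open import Relation.Nullary using (¬_)

-- A finite set S of positive integers is given as a list of naturals
-- (only membership matters). Sequences (a_n)_{n ≥ 1} are functions
-- ℕ → ℕ whose value at 0 is irrelevant.

Admissible : List ℕ → ℕ → List ℕ → Set
Admissible S n L =
  Unique L
  × (∀ {i} → i ∈ L → 1 ≤ i × i < n)
  × (∀ {i j} → i ∈ L → j ∈ L → ∣ i - j ∣ ∉ S)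

Representable : List ℕ → (ℕ → ℕ) → ℕ → ℕ → Set
Representable S a n m =
  Σ (List ℕ) (λ L → Admissible S n L × sum (map a L) ≡ m)

IsLID : List ℕ → (ℕ → ℕ) → Set
IsLID S a =
  ∀ n → 1 ≤ n →
    (1 ≤ a n)
    × ¬ Representable S a n (a n)
    × (∀ m → 1 ≤ m → m < a n → Representable S a n m)

-- Σ_{i ≥ 0, i·d < m} a_{m - i·d}   (for d ≥ 1 all such i are < m)
stepSum : (ℕ → ℕ) → ℕ → ℕ → ℕ
stepSum a d m = sum (map (λ i → a (m ∸ i * d)) (filter (λ i → i * d <? m) (upTo m)))

-- An S-LID sequence is strictly increasing, and since every j with
-- 1 ≤ j < d = k - c lies in S, the indices of an admissible set are pairwise
-- at least d apart. For an increasing sequence, the largest sum over a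
-- d-separated subset of {1, …, N} is the greedy one a_N + a_{N-d} + ⋯, i.e.
-- stepSum a d N. Hence a representation of a_n + a_{n-k} at stage n + 1 must
-- use the index n. The other indices then avoid n - k (at distance k ∈ S from
-- n) and cannot exceed it (a is increasing), so they would represent a_{n-k}
-- at stage n - k, which is impossible. Conversely, a value strictly between
-- a_n and a_n + a_{n-k} is a_n plus a representation of a value below a_{n-k}
-- by indices below n - k, all farther than k = max S from n.
module Submission where

open import Defs
open import Data.Nat
open import Data.Nat.Properties
open import Data.Nat.ListAction using (sum)
open import Data.Nat.ListAction.Properties using (sum-++; sum-↭)
open import Data.Nat.Induction using (<-wellFounded)
open import Induction.WellFounded using (Acc; acc)
open import Data.List using (List; []; _∷_; [_]; _++_; map; filter; upTo; applyUpTo)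
open import Data.List.Properties using (upTo-∷ʳ; map-upTo; map-++; filter-++; filter-accept; filter-reject)
open import Data.List.Membership.Propositional using (_∈_; _∉_)
open import Data.List.Membership.Propositional.Properties using (∈-∃++)
open import Data.List.Membership.DecPropositional _≟_ using (_∈?_)
open import Data.List.Relation.Unary.Any using (here; there)
open import Data.List.Relation.Unary.All as All using ([])
open import Data.List.Relation.Unary.AllPairs using ([]; _∷_)
open import Data.List.Relation.Unary.Unique.Propositional using (Unique)
open import Data.List.Relation.Unary.Unique.Propositional.Properties using (Unique[x∷xs]⇒x∉xs)
open import Data.List.Relation.Binary.Permutation.Propositional using (_↭_; ↭-sym; ↭⇒↭ₛ)
open import Data.List.Relation.Binary.Permutation.Propositional.Properties using (shift; map⁺; ∈-resp-↭)
import Data.List.Relation.Binary.Permutation.Setoid.Properties as ↭ₛ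
open import Data.Product using (∃; _×_; _,_; proj₁; proj₂)
open import Data.Sum using (inj₁; inj₂)
open import Function using (_∘_)
open import Relation.Binary.PropositionalEquality hiding ([_])
open import Relation.Binary.PropositionalEquality.Properties using (setoid)
open import Relation.Nullary using (¬_; Dec; yes; no; contradiction)
open import Relation.Binary.Definitions using (tri<; tri≈; tri>)

∈⇒↭∷ : {A : Set} {x : A} {xs : List A} → x ∈ xs → ∃ λ ys → xs ↭ x ∷ ys
∈⇒↭∷ x∈xs with ys , zs , refl ← ∈-∃++ x∈xs = ys ++ zs , shift _ ys zs

Unique-resp-↭ : {xs ys : List ℕ} → xs ↭ ys → Unique xs → Unique ys
Unique-resp-↭ σ = ↭ₛ.Unique-resp-↭ (setoid ℕ) (↭⇒↭ₛ σ)

sum-map-↭ : (f : ℕ → ℕ) {xs ys : List ℕ} → xs ↭ ys → sum (map f xs) ≡ sum (map f ys)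
sum-map-↭ f σ = sum-↭ (map⁺ f σ)

∈⇒≤sum-map : (f : ℕ → ℕ) {x : ℕ} {xs : List ℕ} → x ∈ xs → f x ≤ sum (map f xs)
∈⇒≤sum-map f x∈xs with _ , σ ← ∈⇒↭∷ x∈xs = subst (f _ ≤_) (sym (sum-map-↭ f σ)) (m≤m+n _ _)

+-<⇒<∸ : ∀ {m n o} → n + m < o → m < o ∸ n
+-<⇒<∸ {m} {n} {o} p = m+n≤o⇒m≤o∸n (suc m) (subst (_≤ o) (cong suc (+-comm n m)) p)

<∸⇒+-< : ∀ {m n o} → m < o ∸ n → n + m < o
<∸⇒+-< {m} {n} {o} p = subst (_≤ o) (cong suc (+-comm m n)) (m≤o∸n⇒m+n≤o (suc m) n≤o p)
  where
  n≤o : n ≤ o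
  n≤o = <⇒≤ (m∸n≢0⇒n<m (m<n⇒n≢0 p))

≤∸-of-gap : ∀ {i m d} → i ≤ m → d ≤ m ∸ i → i ≤ m ∸ d
≤∸-of-gap {i} {m} {d} i≤m d≤m∸i = m+n≤o⇒m≤o∸n i (subst (_≤ m) (+-comm d i) (m≤o∸n⇒m+n≤o d i≤m d≤m∸i))

Separated : ℕ → List ℕ → Set
Separated d L = ∀ {i j} → i ∈ L → j ∈ L → i ≢ j → d ≤ ∣ i - j ∣

module StepSum (a : ℕ → ℕ) {d : ℕ} (1≤d : 1 ≤ d) where

  stepSumOver : ℕ → List ℕ → ℕ
  stepSumOver m xs = sum (map (λ i → a (m ∸ i * d)) (filter (λ i → i * d <? m) xs))

  stepSumOver-accept : ∀ m {i} xs → i * d < m → stepSumOver m (i ∷ xs) ≡ a (m ∸ i * d) + stepSumOver m xs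
  stepSumOver-accept m xs p = cong (sum ∘ map _) (filter-accept (λ i → i * d <? m) p)

  stepSumOver-reject : ∀ m {i} xs → ¬ i * d < m → stepSumOver m (i ∷ xs) ≡ stepSumOver m xs
  stepSumOver-reject m xs p = cong (sum ∘ map _) (filter-reject (λ i → i * d <? m) p)

  stepSumOver-++ : ∀ m xs ys → stepSumOver m (xs ++ ys) ≡ stepSumOver m xs + stepSumOver m ys
  stepSumOver-++ m xs ys = begin
    sum (map f (filter P? (xs ++ ys)))                 ≡⟨ cong (sum ∘ map f) (filter-++ P? xs ys) ⟩
    sum (map f (filter P? xs ++ filter P? ys))         ≡⟨ cong sum (map-++ f (filter P? xs) _) ⟩
    sum (map f (filter P? xs) ++ map f (filter P? ys)) ≡⟨ sum-++ (map f (filter P? xs)) _ ⟩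
    stepSumOver m xs + stepSumOver m ys                ∎
    where
    open ≡-Reasoning
    f : ℕ → ℕ
    f i = a (m ∸ i * d)
    P? : ∀ i → Dec (i * d < m)
    P? i = i * d <? m

  stepSumOver-upTo-+ : ∀ m j → stepSumOver m (upTo (m + j)) ≡ stepSumOver m (upTo m)
  stepSumOver-upTo-+ m zero = cong (stepSumOver m ∘ upTo) (+-identityʳ m)
  stepSumOver-upTo-+ m (suc j) = begin
    stepSumOver m (upTo (m + suc j))                       ≡⟨ cong (stepSumOver m ∘ upTo) (+-suc m j) ⟩
    stepSumOver m (upTo (suc (m + j)))                     ≡⟨ cong (stepSumOver m) (upTo-∷ʳ (m + j)) ⟨
    stepSumOver m (upTo (m + j) ++ [ m + j ])              ≡⟨ stepSumOver-++ m (upTo (m + j)) _ ⟩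
    stepSumOver m (upTo (m + j)) + stepSumOver m [ m + j ] ≡⟨ cong₂ _+_ (stepSumOver-upTo-+ m j) (stepSumOver-reject m [] out-of-range) ⟩
    stepSumOver m (upTo m) + 0                             ≡⟨ +-identityʳ _ ⟩
    stepSumOver m (upTo m)                                 ∎
    where
    open ≡-Reasoning
    out-of-range : ¬ (m + j) * d < m
    out-of-range p = <⇒≱ p (≤-trans (m≤m+n m j) (m≤m*n (m + j) d {{>-nonZero 1≤d}}))

  stepSumOver-map-suc : ∀ m xs → stepSumOver m (map suc xs) ≡ stepSumOver (m ∸ d) xs
  stepSumOver-map-suc m [] = refl
  stepSumOver-map-suc m (x ∷ xs) with x * d <? m ∸ d
  ... | yes p = begin
    stepSumOver m (suc x ∷ map suc xs)               ≡⟨ stepSumOver-accept m _ (<∸⇒+-< p) ⟩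
    a (m ∸ (d + x * d)) + stepSumOver m (map suc xs) ≡⟨ cong₂ _+_ (cong a (sym (∸-+-assoc m d (x * d)))) (stepSumOver-map-suc m xs) ⟩
    a (m ∸ d ∸ x * d) + stepSumOver (m ∸ d) xs       ≡⟨ stepSumOver-accept (m ∸ d) xs p ⟨
    stepSumOver (m ∸ d) (x ∷ xs)                     ∎
    where open ≡-Reasoning
  ... | no p = trans (stepSumOver-reject m _ (p ∘ +-<⇒<∸)) (trans (stepSumOver-map-suc m xs) (sym (stepSumOver-reject (m ∸ d) xs p)))

  stepSum-suc : ∀ m → stepSum a d (suc m) ≡ a (suc m) + stepSum a d (suc m ∸ d)
  -- The index-0 term splits off definitionally: upTo (suc m) = 0 ∷ applyUpTo suc m.
  stepSum-suc m = cong (a (suc m) +_) (begin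
    stepSumOver (suc m) (applyUpTo suc m)  ≡⟨ cong (stepSumOver (suc m)) (map-upTo suc m) ⟨
    stepSumOver (suc m) (map suc (upTo m)) ≡⟨ stepSumOver-map-suc (suc m) (upTo m) ⟩
    stepSumOver r (upTo m)                 ≡⟨ cong (stepSumOver r ∘ upTo) (m+[n∸m]≡n r≤m) ⟨
    stepSumOver r (upTo (r + (m ∸ r)))     ≡⟨ stepSumOver-upTo-+ r (m ∸ r) ⟩
    stepSum a d r                          ∎)
    where
    open ≡-Reasoning
    r : ℕ
    r = suc m ∸ d
    r≤m : r ≤ m
    r≤m = ∸-monoʳ-≤ (suc m) 1≤d

module _ (a : ℕ → ℕ) {d : ℕ} (1≤d : 1 ≤ d) (a-mono : ∀ {i j} → 1 ≤ i → i ≤ j → a i ≤ a j) where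
  open StepSum a 1≤d

  stepSum-mono-suc : ∀ m → Acc _<_ m → stepSum a d m ≤ stepSum a d (suc m)
  stepSum-mono-suc zero _ = z≤n
  stepSum-mono-suc (suc m) (acc rec) = begin
    stepSum a d (suc m)                             ≡⟨ stepSum-suc m ⟩
    a (suc m) + stepSum a d (suc m ∸ d)             ≤⟨ +-mono-≤ (a-mono (s≤s z≤n) (n≤1+n _)) tail-mono ⟩
    a (suc (suc m)) + stepSum a d (suc (suc m) ∸ d) ≡⟨ stepSum-suc (suc m) ⟨
    stepSum a d (suc (suc m))                       ∎
    where
    open ≤-Reasoning
    tail-mono : stepSum a d (suc m ∸ d) ≤ stepSum a d (suc (suc m) ∸ d)
    tail-mono with d ≤? suc m
    ... | yes d≤1+m = subst (λ r → stepSum a d (suc m ∸ d) ≤ stepSum a d r) (sym (+-∸-assoc 1 d≤1+m))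
                        (stepSum-mono-suc (suc m ∸ d) (rec (s≤s (∸-monoʳ-≤ (suc m) 1≤d))))
    ... | no d≰1+m = subst (λ r → stepSum a d r ≤ stepSum a d (suc (suc m) ∸ d)) (sym (m≤n⇒m∸n≡0 (<⇒≤ (≰⇒> d≰1+m)))) z≤n

  sum-separated≤stepSum : ∀ m → Acc _<_ m → ∀ L → Unique L → (∀ {i} → i ∈ L → 1 ≤ i × i ≤ m) →
                          Separated d L → sum (map a L) ≤ stepSum a d m
  sum-separated≤stepSum zero _ [] _ _ _ = z≤n
  sum-separated≤stepSum zero _ (i ∷ L) _ bounds _ with bounds (here refl)
  ... | 1≤i , i≤0 = contradiction (≤-trans 1≤i i≤0) λ ()
  sum-separated≤stepSum (suc m) (acc rec) L u bounds sep with suc m ∈? L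
  ... | no 1+m∉L = ≤-trans (sum-separated≤stepSum m (rec ≤-refl) L u bounds′ sep) (stepSum-mono-suc m (<-wellFounded m))
    where
    bounds′ : ∀ {i} → i ∈ L → 1 ≤ i × i ≤ m
    bounds′ i∈L = proj₁ (bounds i∈L) , s≤s⁻¹ (≤∧≢⇒< (proj₂ (bounds i∈L)) (λ { refl → 1+m∉L i∈L }))
  ... | yes 1+m∈L with L′ , σ ← ∈⇒↭∷ 1+m∈L = begin
    sum (map a L)                       ≡⟨ sum-map-↭ a σ ⟩
    a (suc m) + sum (map a L′)          ≤⟨ +-monoʳ-≤ (a (suc m)) (sum-separated≤stepSum (suc m ∸ d) (rec r<1+m) L′ u′ bounds′ sep′) ⟩
    a (suc m) + stepSum a d (suc m ∸ d) ≡⟨ stepSum-suc m ⟨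
    stepSum a d (suc m)                 ∎
    where
    open ≤-Reasoning
    r<1+m : suc m ∸ d < suc m
    r<1+m = s≤s (∸-monoʳ-≤ (suc m) 1≤d)
    L′⊆L : ∀ {i} → i ∈ L′ → i ∈ L
    L′⊆L i∈L′ = ∈-resp-↭ (↭-sym σ) (there i∈L′)
    u∷ : Unique (suc m ∷ L′)
    u∷ = Unique-resp-↭ σ u
    u′ : Unique L′
    u′ with _ ∷ u′ ← u∷ = u′
    sep′ : Separated d L′
    sep′ i∈L′ j∈L′ = sep (L′⊆L i∈L′) (L′⊆L j∈L′)
    bounds′ : ∀ {i} → i ∈ L′ → 1 ≤ i × i ≤ suc m ∸ d
    bounds′ {i} i∈L′ = proj₁ (bounds (L′⊆L i∈L′)) , ≤∸-of-gap i≤1+m gap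
      where
      i≤1+m : i ≤ suc m
      i≤1+m = proj₂ (bounds (L′⊆L i∈L′))
      gap : d ≤ suc m ∸ i
      gap = subst (d ≤_) (m≤n⇒∣m-n∣≡n∸m i≤1+m)
              (sep (L′⊆L i∈L′) 1+m∈L (λ { refl → Unique[x∷xs]⇒x∉xs u∷ i∈L′ }))

Representable-mono : ∀ {S a m m′ x} → m ≤ m′ → Representable S a m x → Representable S a m′ x
Representable-mono m≤m′ (L , (u , bounds , dist) , sum≡x) =
  L , (u , (λ i∈L → proj₁ (bounds i∈L) , <-≤-trans (proj₂ (bounds i∈L)) m≤m′) , dist) , sum≡x

singleton-admissible : ∀ {S i m} → 0 ∉ S → 1 ≤ i → i < m → Admissible S m [ i ]
singleton-admissible {S} {i} 0∉S 1≤i i<m =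
  ([] ∷ []) , (λ { (here refl) → 1≤i , i<m }) , λ { (here refl) (here refl) → subst (_∉ S) (sym (∣n-n∣≡0 i)) 0∉S }

admissible⇒separated : ∀ {S d m L} → (∀ j → 1 ≤ j → j < d → j ∈ S) → Admissible S m L → Separated d L
admissible⇒separated {d = d} below-d⊆S (_ , _ , dist) {i} {j} i∈L j∈L i≢j with d ≤? ∣ i - j ∣
... | yes d≤∣i-j∣ = d≤∣i-j∣
... | no d≰∣i-j∣ = contradiction (below-d⊆S _ (n≢0⇒n>0 (i≢j ∘ ∣m-n∣≡0⇒m≡n)) (≰⇒> d≰∣i-j∣)) (dist i∈L j∈L)

far-from-below : ∀ {i n k} → i < n ∸ k → k < ∣ n - i ∣
far-from-below {i} {n} {k} i<n∸k =
  subst (k <_) (sym (m≤n⇒∣n-m∣≡n∸m (m+n≤o⇒n≤o k (<⇒≤ k+i<n)))) (+-<⇒<∸ (subst (_< n) (+-comm k i) k+i<n))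
  where
  k+i<n : k + i < n
  k+i<n = <∸⇒+-< i<n∸k

Representable-extend-far : ∀ {S a k n x} → 0 ∉ S → (∀ {s} → s ∈ S → s ≤ k) → 1 ≤ n →
                           Representable S a (n ∸ k) x → Representable S a (suc n) (a n + x)
Representable-extend-far {S} {a} {k} {n} 0∉S S≤k 1≤n (L , (u , bounds , dist) , sum≡x) =
  n ∷ L , (All.tabulate n≢ ∷ u , bounds′ , dist′) , cong (a n +_) sum≡x
  where
  below : ∀ {i} → i ∈ L → i < n
  below i∈L = <-≤-trans (proj₂ (bounds i∈L)) (m∸n≤m n k)
  n≢ : ∀ {i} → i ∈ L → n ≢ i
  n≢ i∈L n≡i = <⇒≢ (below i∈L) (sym n≡i)
  bounds′ : ∀ {i} → i ∈ n ∷ L → 1 ≤ i × i < suc n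
  bounds′ (here refl) = 1≤n , ≤-refl
  bounds′ (there i∈L) = proj₁ (bounds i∈L) , m<n⇒m<1+n (below i∈L)
  n-far : ∀ {i} → i ∈ L → ∣ n - i ∣ ∉ S
  n-far i∈L s∈S = <⇒≱ (far-from-below (proj₂ (bounds i∈L))) (S≤k s∈S)
  dist′ : ∀ {i j} → i ∈ n ∷ L → j ∈ n ∷ L → ∣ i - j ∣ ∉ S
  dist′ (here refl) (here refl) = subst (_∉ S) (sym (∣n-n∣≡0 n)) 0∉S
  dist′ (here refl) (there j∈L) = n-far j∈L
  dist′ {i} (there i∈L) (here refl) = subst (_∉ S) (∣-∣-comm n i) (n-far i∈L)
  dist′ (there i∈L) (there j∈L) = dist i∈L j∈L

module _ {S : List ℕ} {a : ℕ → ℕ} (0∉S : 0 ∉ S) (lid : IsLID S a) where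

  LID-<-suc : ∀ {i} → 1 ≤ i → a i < a (suc i)
  LID-<-suc {i} 1≤i with lid (suc i) (s≤s z≤n) | <-cmp (a i) (a (suc i))
  ... | _ | tri< a[i]<a[1+i] _ _ = a[i]<a[1+i]
  ... | _ , ¬rep , _ | tri≈ _ a[i]≡a[1+i] _ =
    contradiction ([ i ] , singleton-admissible 0∉S 1≤i ≤-refl , trans (+-identityʳ (a i)) a[i]≡a[1+i]) ¬rep
  ... | 1≤a[1+i] , ¬rep , _ | tri> _ _ a[1+i]<a[i] =
    contradiction (Representable-mono (n≤1+n i) (proj₂ (proj₂ (lid i 1≤i)) _ 1≤a[1+i] a[1+i]<a[i])) ¬rep

  LID-< : ∀ {i j} → 1 ≤ i → i < j → a i < a j
  LID-< {i} {suc j} 1≤i i<1+j with m≤n⇒m<n∨m≡n (s≤s⁻¹ i<1+j)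
  ... | inj₁ i<j = <-trans (LID-< 1≤i i<j) (LID-<-suc (≤-trans 1≤i (<⇒≤ i<j)))
  ... | inj₂ refl = LID-<-suc 1≤i

  LID-≤ : ∀ {i j} → 1 ≤ i → i ≤ j → a i ≤ a j
  LID-≤ 1≤i i≤j with m≤n⇒m<n∨m≡n i≤j
  ... | inj₁ i<j = <⇒≤ (LID-< 1≤i i<j)
  ... | inj₂ refl = ≤-refl

  LID-≡-least-nonrepresentable : ∀ {m v} → 1 ≤ m → 1 ≤ v → ¬ Representable S a m v →
                                 (∀ x → 1 ≤ x → x < v → Representable S a m x) → a m ≡ v
  LID-≡-least-nonrepresentable {m} {v} 1≤m 1≤v ¬rep[v] rep[<v] with lid m 1≤m | <-cmp (a m) v
  ... | 1≤a[m] , ¬rep[a[m]] , _ | tri< a[m]<v _ _ = contradiction (rep[<v] (a m) 1≤a[m] a[m]<v) ¬rep[a[m]]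
  ... | _ | tri≈ _ a[m]≡v _ = a[m]≡v
  ... | _ , _ , rep[<a[m]] | tri> _ _ v<a[m] = contradiction (rep[<a[m]] v 1≤v v<a[m]) ¬rep[v]

  module _ {k n : ℕ} (k<n : k < n) where

    private
      1≤n∸k : 1 ≤ n ∸ k
      1≤n∸k = m<n⇒0<n∸m k<n
      1≤n : 1 ≤ n
      1≤n = ≤-trans 1≤n∸k (m∸n≤m n k)

    representable-below-target : (∀ {s} → s ∈ S → s ≤ k) →
                                 ∀ x → 1 ≤ x → x < a n + a (n ∸ k) → Representable S a (suc n) x
    representable-below-target S≤k x 1≤x x<target with <-cmp x (a n)
    ... | tri< x<a[n] _ _ = Representable-mono (n≤1+n n) (proj₂ (proj₂ (lid n 1≤n)) x 1≤x x<a[n])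
    ... | tri≈ _ refl _ = [ n ] , singleton-admissible 0∉S 1≤n ≤-refl , +-identityʳ (a n)
    ... | tri> _ _ a[n]<x = subst (Representable S a (suc n)) (m+[n∸m]≡n a[n]≤x)
            (Representable-extend-far 0∉S S≤k 1≤n (proj₂ (proj₂ (lid (n ∸ k) 1≤n∸k)) (x ∸ a n) (m<n⇒0<n∸m a[n]<x) rest<))
      where
      a[n]≤x : a n ≤ x
      a[n]≤x = <⇒≤ a[n]<x
      rest< : x ∸ a n < a (n ∸ k)
      rest< = +-cancelˡ-< (a n) _ _ (subst (_< a n + a (n ∸ k)) (sym (m+[n∸m]≡n a[n]≤x)) x<target)

    Representable-remove-top : k ∈ S → ∀ {L} → Admissible S (suc n) L → n ∈ L →
                               sum (map a L) ≡ a n + a (n ∸ k) → Representable S a (n ∸ k) (a (n ∸ k))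
    Representable-remove-top k∈S {L} (u , bounds , dist) n∈L sum≡target with L′ , σ ← ∈⇒↭∷ n∈L =
      L′ , (u′ , bounds′ , (λ i∈L′ j∈L′ → dist (L′⊆L i∈L′) (L′⊆L j∈L′))) , sum≡
      where
      L′⊆L : ∀ {i} → i ∈ L′ → i ∈ L
      L′⊆L i∈L′ = ∈-resp-↭ (↭-sym σ) (there i∈L′)
      u′ : Unique L′
      u′ with _ ∷ u′ ← Unique-resp-↭ σ u = u′
      sum≡ : sum (map a L′) ≡ a (n ∸ k)
      sum≡ = +-cancelˡ-≡ (a n) _ _ (trans (sym (sum-map-↭ a σ)) sum≡target)
      ∣n∸k-n∣≡k : ∣ n ∸ k - n ∣ ≡ k
      ∣n∸k-n∣≡k = trans (m≤n⇒∣m-n∣≡n∸m (m∸n≤m n k)) (m∸[m∸n]≡n (<⇒≤ k<n))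
      bounds′ : ∀ {i} → i ∈ L′ → 1 ≤ i × i < n ∸ k
      bounds′ {i} i∈L′ with <-cmp i (n ∸ k)
      ... | tri< i<n∸k _ _ = proj₁ (bounds (L′⊆L i∈L′)) , i<n∸k
      ... | tri≈ _ refl _ = contradiction (subst (_∈ S) (sym ∣n∸k-n∣≡k) k∈S) (dist (L′⊆L i∈L′) n∈L)
      ... | tri> _ _ n∸k<i = contradiction (subst (a i ≤_) sum≡ (∈⇒≤sum-map a i∈L′)) (<⇒≱ (LID-< 1≤n∸k n∸k<i))

    target-not-representable : ∀ {d} → k ∈ S → 1 ≤ d → (∀ j → 1 ≤ j → j < d → j ∈ S) →
                               stepSum a d (n ∸ 1) < a n + a (n ∸ k) → ¬ Representable S a (suc n) (a n + a (n ∸ k))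
    target-not-representable {d} k∈S 1≤d below-d⊆S stepSum<target (L , adm@(u , bounds , _) , sum≡target) with n ∈? L
    ... | yes n∈L = proj₁ (proj₂ (lid (n ∸ k) 1≤n∸k)) (Representable-remove-top k∈S adm n∈L sum≡target)
    ... | no n∉L = <⇒≱ stepSum<target (subst (_≤ stepSum a d (n ∸ 1)) sum≡target
                     (sum-separated≤stepSum a 1≤d LID-≤ (n ∸ 1) (<-wellFounded _) L u bounds′ (admissible⇒separated below-d⊆S adm)))
      where
      bounds′ : ∀ {i} → i ∈ L → 1 ≤ i × i ≤ n ∸ 1
      bounds′ {i} i∈L = proj₁ (bounds i∈L) , subst (i ≤_) (pred[m∸n]≡m∸[1+n] n 0)
                      (<⇒≤pred (≤∧≢⇒< (s≤s⁻¹ (proj₂ (bounds i∈L))) λ { refl → n∉L i∈L }))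

lemma3p1 : (S : List ℕ) (k c : ℕ) (a : ℕ → ℕ) →
    (∀ {s} → s ∈ S → 1 ≤ s) →
    k ∈ S → (∀ {s} → s ∈ S → s ≤ k) →
    0 < c →
    1 ≤ k ∸ c → k ∸ c ∉ S → (∀ j → 1 ≤ j → j < k ∸ c → j ∈ S) →
    IsLID S a →
    (n : ℕ) → k + 1 ≤ n →
    stepSum a (k ∸ c) (n ∸ 1) < a n + a (n ∸ k) →
    a (n + 1) ≡ a n + a (n ∸ k)
lemma3p1 S k c a S-positive k∈S S≤k _ 1≤d _ below-d⊆S lid n k+1≤n stepSum<target = begin
  a (n + 1)   ≡⟨ cong a (+-comm n 1) ⟩
  a (suc n)   ≡⟨ LID-≡-least-nonrepresentable 0∉S lid (s≤s z≤n) 1≤target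
                   (target-not-representable 0∉S lid k<n k∈S 1≤d below-d⊆S stepSum<target)
                   (representable-below-target 0∉S lid k<n S≤k) ⟩
  a n + a (n ∸ k) ∎
  where
  open ≡-Reasoning
  0∉S : 0 ∉ S
  0∉S 0∈S with () ← S-positive 0∈S
  k<n : k < n
  k<n = subst (_≤ n) (+-comm k 1) k+1≤n
  1≤target : 1 ≤ a n + a (n ∸ k)
  1≤target = ≤-trans (proj₁ (lid n (≤-trans (s≤s z≤n) k<n))) (m≤m+n (a n) _)
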